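{- Let $q$ be an odd prime power and $m\ge2$ an integer with $m\mid q+1$. Let $c_1,\dots,c_{\frac{q+1-m}{m}}$ be the points where the line $\mathbb{F}_q$ meets the $m$-ary lines through $\alpha$ other than the line $\{c+\alpha:c\in\mathbb{F}_q\}$. If $m\nmid\frac{q+1}{2}$, then $\{\alpha,c_1,\dots,c_{\frac{q+1-m}{m}}\}$ is a clique of size $\frac{q+1}{m}$ in $\mathrm{GP}(q^2,m)$; if $m\mid\frac{q+1}{2}$, then $\{\pm\alpha,c_1,\dots,c_{\frac{q+1-m}{m}}\}$ is a clique of size $\frac{q+1+m}{m}$ in $\mathrm{GP}(q^2,m)$.
   Context: The generalised Paley graph $\mathrm{GP}(q^2,m)$ has vertex set $\mathbb{F}_{q^2}$, with two distinct vertices $x,y$ adjacent iff $x-y$ is an $m$-th power of an element of $\mathbb{F}_{q^2}^*$. Fix a non-square $d\in\mathbb{F}_q^*$ and $\alpha\in\mathbb{F}_{q^2}$ with $\alpha^2=d$, so $\mathbb{F}_{q^2}=\{x+y\alpha:x,y\in\mathbb{F}_q\}$ is identified with the affine plane $AG(2,q)$. A line is a set $\{a+cs:c\in\mathbb{F}_q\}$ with $a\in\mathbb{F}_{q^2}$, $s\in\mathbb{F}_{q^2}^*$; $s$ is its slope (defined up to a factor in $\mathbb{F}_q^*$), and the line is $m$-ary if its slope is an $m$-th power in $\mathbb{F}_{q^2}^*$. There are exactly $\frac{q+1}{m}$ $m$-ary lines through each point. -}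

module Defs where

open import Level using (0ℓ)
open import Data.Nat as ℕ using (ℕ; zero; suc)
open import Data.Nat.Primality using (Prime)
open import Data.Product using (Σ; ∃; ∃-syntax; _×_; _,_; proj₁; proj₂)
open import Data.List using (List; _∷_; []; length; map)
open import Data.List.Membership.Propositional using (_∈_)
open import Data.List.Relation.Unary.Unique.Propositional using (Unique)
open import Relation.Binary.PropositionalEquality using (_≡_; _≢_)
open import Relation.Binary.Definitions using (DecidableEquality)
open import Algebra.Structures using (IsCommutativeRing)

record FiniteField : Set₁ where
  infixl 6 _+_
  infixl 7 _*_
  field
    Carrier  : Set
    _≟_      : DecidableEquality Carrier
    _+_ _*_  : Carrier → Carrier → Carrier
    -_       : Carrier → Carrier
    0# 1#    : Carrier
    isCommutativeRing : IsCommutativeRing _≡_ _+_ _*_ -_ 0# 1#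
    0≢1      : 0# ≢ 1#
    inverse  : ∀ x → x ≢ 0# → ∃[ y ] (x * y ≡ 1#)
    elements : List Carrier
    complete : ∀ x → x ∈ elements
    unique   : Unique elements

  order : ℕ
  order = length elements

IsPrimePower : ℕ → Set
IsPrimePower q = ∃[ p ] ∃[ k ] (Prime p × q ≡ p ℕ.^ suc k)

module QuadExt (F : FiniteField) (d : FiniteField.Carrier F) where
  open FiniteField F

  -- F_{q^2} = { x + y α : x, y ∈ F_q } with α² = d, as pairs (x , y)
  Fq² : Set
  Fq² = Carrier × Carrier

  embed : Carrier → Fq²
  embed c = c , 0#

  α : Fq²
  α = 0# , 1#

  0² 1² : Fq²
  0² = 0# , 0#
  1² = 1# , 0#

  _⊕_ : Fq² → Fq² → Fq²
  (a , b) ⊕ (c , e) = a + c , b + e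

  ⊖_ : Fq² → Fq²
  ⊖ (a , b) = - a , - b

  _⊖_ : Fq² → Fq² → Fq²
  u ⊖ v = u ⊕ (⊖ v)

  -- (a + bα)(c + eα) = (ac + d be) + (ae + bc)α
  _⊗_ : Fq² → Fq² → Fq²
  (a , b) ⊗ (c , e) = (a * c + d * (b * e)) , (a * e + b * c)

  _·_ : Carrier → Fq² → Fq²
  t · u = embed t ⊗ u

  _^_ : Fq² → ℕ → Fq²
  u ^ zero  = 1²
  u ^ suc n = u ⊗ (u ^ n)

  IsPower : ℕ → Fq² → Set
  IsPower m x = ∃[ z ] (z ≢ 0² × z ^ m ≡ x)

  Adj : ℕ → Fq² → Fq² → Set
  Adj m x y = x ≢ y × IsPower m (x ⊖ y)

  IsClique : ℕ → List Fq² → Set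
  IsClique m xs = ∀ {x y} → x ∈ xs → y ∈ xs → x ≢ y → Adj m x y

  -- The line {α + t s : t ∈ F_q} with slope s is m-ary (s an m-th power in
  -- F_{q²}^*), is not the line {c + α : c ∈ F_q} (slope 1, i.e. s ∉ F_q^*·1,
  -- i.e. second coordinate of s nonzero), and c ∈ F_q lies on it.
  IsMeetPoint : ℕ → Carrier → Set
  IsMeetPoint m c =
    ∃[ s ] (s ≢ 0² × IsPower m s × proj₂ s ≢ 0#
            × ∃[ t ] (α ⊕ (t · s) ≡ embed c))

IsNonSquare : (F : FiniteField) → FiniteField.Carrier F → Set
IsNonSquare F d = d ≢ FiniteField.0# F × (∀ y → FiniteField._*_ F y y ≢ d)

-- Let q = |F| and e = (q² - 1) / m.  In F_q² the m-th powers of units are exactly the roots of X^e - 1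
-- (the m-th power map has fibres of size at most m, and X^e - 1 has at most e roots), so there are e of
-- them, and they include F_q^* because q - 1 divides e.  A point c of F_q lies on an m-ary line through α
-- iff c - α is an m-th power; sorting the e powers by slope gives (q - 1)(1 + #cs) = e, i.e.
-- #cs = (q + 1)/m - 1.  In the clique, c - c' ∈ F_q^*, c - α and its conjugate c + α are m-th powers,
-- and when m ∣ (q + 1)/2, so is 2α, whose square 4d lies in F_q^*.
module Submission where

open import Defs
open import Level using (0ℓ)
open import Data.Nat as ℕ using (ℕ; zero; suc; _≤_; _<_; _≥_; _/_; z≤n; s≤s; NonZero)
import Data.Nat.Properties as ℕ
open import Data.Integer as ℤ using (ℤ; 0ℤ; 1ℤ)
import Data.Integer.Properties as ℤ
open import Data.Maybe using (Maybe; just; nothing)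
open import Data.Nat.Divisibility using (_∣_; divides; ∣m∣n⇒∣m+n; m∣n/o⇒m*o∣n; *-cancelˡ-∣)
open import Data.Product using (∃-syntax; _×_; _,_; proj₁; proj₂; assocʳ′)
open import Data.Product.Properties using (≡-dec)
open import Data.Sum using (_⊎_; inj₁; inj₂; reduce)
open import Data.List using (List; []; _∷_; [_]; _++_; length; map; filter; foldr; replicate; cartesianProduct)
open import Data.List.Properties using (length-map; length-++; length-++-sucʳ; length-replicate)
open import Data.List.Membership.Propositional using (_∈_; lose)
open import Data.List.Membership.Propositional.Properties
  using (∈-map⁺; ∈-map⁻; ∈-++⁺ˡ; ∈-++⁺ʳ; ∈-++⁻; ∈-∃++; ∈-filter⁺; ∈-filter⁻; ∈-cartesianProduct⁺; ∈-cartesianProduct⁻)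
open import Data.List.Membership.Propositional.Properties.WithK using (unique∧set⇒bag)
open import Data.List.Relation.Binary.BagAndSetEquality using (∼bag⇒↭)
open import Data.List.Relation.Binary.Subset.Propositional using (_⊆_)
open import Data.List.Relation.Binary.Permutation.Propositional using (_↭_; ↭⇒↭ₛ)
open import Data.List.Relation.Binary.Permutation.Propositional.Properties using (↭-length)
import Data.List.Relation.Binary.Permutation.Setoid.Properties as Permutation
open import Data.List.Relation.Unary.Any as Any using (here; there; any?)
open import Data.List.Relation.Unary.All as All using (All; []; _∷_)
open import Data.List.Relation.Unary.AllPairs using ([]; _∷_)
open import Data.List.Relation.Unary.Unique.Propositional using (Unique)
import Data.List.Relation.Unary.Unique.Propositional.Properties as Unique
open import Relation.Nullary using (¬_; Dec; yes; no; ¬?; _×-dec_; contradiction)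
open import Relation.Unary using (Pred; Decidable)
open import Relation.Unary.Properties using (∁?)
open import Relation.Binary.PropositionalEquality hiding ([_])
open import Function.Base using (_∘′_; case_of_)
open import Function.Bundles using (_⇔_; mk⇔; Equivalence)
open import Algebra.Core using (Op₂)
open import Algebra.Structures using (IsCommutativeMonoid; IsCommutativeRing)
open import Algebra.Bundles using (CommutativeMonoid; CommutativeRing)
import Algebra.Definitions.RawMonoid as RawMonoidDefinitions
import Algebra.Properties.CommutativeSemigroup as CommutativeSemigroupProperties
open import Algebra.Solver.Ring.AlmostCommutativeRing using (fromCommutativeRing; _-Raw-AlmostCommutative⟶_)

¬2∣n⇒2∣1+n : ∀ {n} → ¬ 2 ∣ n → 2 ∣ suc n
¬2∣n⇒2∣1+n {zero}        ¬2∣0   = contradiction (divides 0 refl) ¬2∣0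
¬2∣n⇒2∣1+n {suc zero}    _      = divides 1 refl
¬2∣n⇒2∣1+n {suc (suc n)} ¬2∣2+n with ¬2∣n⇒2∣1+n (¬2∣2+n ∘′ ∣m∣n⇒∣m+n (divides 1 refl))
... | divides j 1+n≡j*2 = divides (suc j) (cong (2 ℕ.+_) 1+n≡j*2)

m∣[n+1]/2⇒2∣quotient : ∀ {n m k} .{{_ : NonZero m}} → ¬ 2 ∣ n → suc n ≡ k ℕ.* m → m ∣ suc n / 2 → 2 ∣ k
m∣[n+1]/2⇒2∣quotient {n} {m} {k} n-odd n+1≡k*m m∣[n+1]/2 = *-cancelˡ-∣ m (subst (m ℕ.* 2 ∣_) n+1≡m*k
  (m∣n/o⇒m*o∣n (¬2∣n⇒2∣1+n n-odd) m∣[n+1]/2))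
  where
  n+1≡m*k : suc n ≡ m ℕ.* k
  n+1≡m*k = trans n+1≡k*m (ℕ.*-comm k m)

-- Counting duplicate-free lists

module _ {A : Set} where

  ⊆⇒length≤ : {xs ys : List A} → Unique xs → xs ⊆ ys → length xs ≤ length ys
  ⊆⇒length≤ {[]} _ _ = z≤n
  ⊆⇒length≤ {x ∷ xs} (x∉xs ∷ xs!) xs⊆ys with ∈-∃++ (xs⊆ys (here refl))
  ... | as , bs , refl = subst (suc (length xs) ≤_) (sym (length-++-sucʳ as x bs))
    (s≤s (⊆⇒length≤ xs! λ y∈xs → skip (xs⊆ys (there y∈xs)) (All.lookup x∉xs y∈xs ∘′ sym)))
    where
    skip : ∀ {y} → y ∈ as ++ x ∷ bs → y ≢ x → y ∈ as ++ bs
    skip y∈ y≢x with ∈-++⁻ as y∈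
    ... | inj₁ y∈as         = ∈-++⁺ˡ y∈as
    ... | inj₂ (here y≡x)   = contradiction y≡x y≢x
    ... | inj₂ (there y∈bs) = ∈-++⁺ʳ as y∈bs

  unique-⇔⇒↭ : {xs ys : List A} → Unique xs → Unique ys → (∀ {z} → z ∈ xs ⇔ z ∈ ys) → xs ↭ ys
  unique-⇔⇒↭ xs! ys! same = ∼bag⇒↭ (unique∧set⇒bag xs! ys! same)

  length-filter-∁ : {P : Pred A 0ℓ} (P? : Decidable P) (xs : List A) →
                    length (filter P? xs) ℕ.+ length (filter (∁? P?) xs) ≡ length xs
  length-filter-∁ P? [] = refl
  length-filter-∁ P? (x ∷ xs) with P? x
  ... | yes _ = cong suc (length-filter-∁ P? xs)
  ... | no  _ = trans (ℕ.+-suc _ _) (cong suc (length-filter-∁ P? xs))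

module _ {A B : Set} where

  length-cartesianProduct : (xs : List A) (ys : List B) →
                            length (cartesianProduct xs ys) ≡ length xs ℕ.* length ys
  length-cartesianProduct [] ys = refl
  length-cartesianProduct (x ∷ xs) ys =
    trans (length-++ (map (x ,_) ys)) (cong₂ ℕ._+_ (length-map _ ys) (length-cartesianProduct xs ys))

  InjectiveOn : (A → B) → List A → Set
  InjectiveOn f xs = ∀ {x y} → x ∈ xs → y ∈ xs → f x ≡ f y → x ≡ y

  module _ (f : A → B) where

    unique-map⁺ : ∀ {xs} → Unique xs → InjectiveOn f xs → Unique (map f xs)
    unique-map⁺ [] _ = []
    unique-map⁺ {x ∷ xs} (x∉xs ∷ xs!) inj =
      All.tabulate fx∉ ∷ unique-map⁺ xs! (λ p q → inj (there p) (there q))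
      where
      fx∉ : ∀ {z} → z ∈ map f xs → f x ≢ z
      fx∉ z∈ fx≡z with ∈-map⁻ f z∈
      ... | y , y∈xs , refl = All.lookup x∉xs y∈xs (inj (here refl) (there y∈xs) fx≡z)

    injection⇒length≤ : ∀ {xs ys} → Unique xs → InjectiveOn f xs →
                        (∀ {x} → x ∈ xs → f x ∈ ys) → length xs ≤ length ys
    injection⇒length≤ {xs} xs! inj into = subst (_≤ _) (length-map f xs)
      (⊆⇒length≤ (unique-map⁺ xs! inj) image⊆)
      where
      image⊆ : map f xs ⊆ _
      image⊆ y∈ with ∈-map⁻ f y∈
      ... | x , x∈xs , refl = into x∈xs

    bijection⇒length≡ : ∀ {xs ys} → Unique xs → Unique ys → InjectiveOn f xs →
                        (∀ {x} → x ∈ xs → f x ∈ ys) → (∀ {y} → y ∈ ys → ∃[ x ] (x ∈ xs × f x ≡ y)) →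
                        length xs ≡ length ys
    bijection⇒length≡ {xs} xs! ys! inj into onto = trans (sym (length-map f xs))
      (↭-length (unique-⇔⇒↭ (unique-map⁺ xs! inj) ys! (mk⇔ image⊆ ⊆image)))
      where
      image⊆ : map f xs ⊆ _
      image⊆ y∈ with ∈-map⁻ f y∈
      ... | x , x∈xs , refl = into x∈xs
      ⊆image : _ ⊆ map f xs
      ⊆image y∈ys with onto y∈ys
      ... | x , x∈xs , refl = ∈-map⁺ f x∈xs

module _ {A : Set} {_∙_ : Op₂ A} {ε : A} (isCommutativeMonoid : IsCommutativeMonoid _≡_ _∙_ ε) where
  private
    M : CommutativeMonoid 0ℓ 0ℓ
    M = record { isCommutativeMonoid = isCommutativeMonoid }
  open CommutativeMonoid M using (identityˡ; commutativeSemigroup; rawMonoid)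
  open CommutativeSemigroupProperties commutativeSemigroup using (interchange)
  open RawMonoidDefinitions rawMonoid using () renaming (_×_ to _times_)

  foldr-map-∙ˡ : ∀ c xs → foldr _∙_ ε (map (c ∙_) xs) ≡ (length xs times c) ∙ foldr _∙_ ε xs
  foldr-map-∙ˡ c [] = sym (identityˡ ε)
  foldr-map-∙ˡ c (x ∷ xs) = trans (cong ((c ∙ x) ∙_) (foldr-map-∙ˡ c xs)) (interchange c x _ _)

  foldr-translation-invariant : ∀ c {xs} → map (c ∙_) xs ↭ xs →
                                (length xs times c) ∙ foldr _∙_ ε xs ≡ foldr _∙_ ε xs
  foldr-translation-invariant c {xs} shuffled = trans (sym (foldr-map-∙ˡ c xs))
    (Permutation.foldr-commMonoid (setoid A) isCommutativeMonoid (↭⇒↭ₛ shuffled))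

-- The ring solver over a finite field.  Its coefficients must be closed terms (here integers): with the
-- field's own elements as coefficients the solver's zero test 0# ≟ 0# would not compute.

module RingSolver (K : FiniteField) where
  open FiniteField K

  commutativeRing : CommutativeRing 0ℓ 0ℓ
  commutativeRing = record { isCommutativeRing = isCommutativeRing }

  open CommutativeRing commutativeRing
    using (+-assoc; +-comm; +-identityˡ; +-identityʳ; -‿inverseˡ; ring; +-monoid; +-abelianGroup; semiring)
  open import Algebra.Properties.Ring ring using (-‿distribˡ-*; -‿distribʳ-*; -0#≈0#; -‿involutive)
  open import Algebra.Properties.AbelianGroup +-abelianGroup using (⁻¹-∙-comm)
  open import Algebra.Properties.Monoid.Mult.TCOptimised +-monoid using (×-homo-+; 1+×) renaming (_×_ to _times_)
  open import Algebra.Properties.Semiring.Mult.TCOptimised semiring using (×1-homo-*)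

  -- With the optimised multiples _times_, fromℤ 1ℤ is 1# definitionally, as the solver's constants need.
  fromℤ : ℤ → Carrier
  fromℤ (ℤ.+ n)      = n times 1#
  fromℤ (ℤ.-[1+ n ]) = - (suc n times 1#)

  fromℤ-‿homo : ∀ i → fromℤ (ℤ.- i) ≡ - fromℤ i
  fromℤ-‿homo (ℤ.+ zero) = sym -0#≈0#
  fromℤ-‿homo ℤ.+[1+ n ] = refl
  fromℤ-‿homo ℤ.-[1+ n ] = sym (-‿involutive _)

  fromℤ-⊖ : ∀ m n → fromℤ (m ℤ.⊖ n) ≡ m times 1# + - (n times 1#)
  fromℤ-⊖ m       zero    = sym (trans (cong (m times 1# +_) -0#≈0#) (+-identityʳ _))
  fromℤ-⊖ zero    (suc n) = sym (+-identityˡ _)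
  fromℤ-⊖ (suc m) (suc n) = begin
    fromℤ (suc m ℤ.⊖ suc n)              ≡⟨ cong fromℤ (ℤ.[1+m]⊖[1+n]≡m⊖n m n) ⟩
    fromℤ (m ℤ.⊖ n)                      ≡⟨ fromℤ-⊖ m n ⟩
    a + - b                              ≡⟨ cong (_+ - b) (sym (+-identityˡ a)) ⟩
    (0# + a) + - b                       ≡⟨ cong (λ z → (z + a) + - b) (sym (-‿inverseˡ 1#)) ⟩
    ((- 1# + 1#) + a) + - b              ≡⟨ cong (_+ - b) (+-assoc (- 1#) 1# a) ⟩
    (- 1# + (1# + a)) + - b              ≡⟨ cong (_+ - b) (+-comm (- 1#) _) ⟩
    ((1# + a) + - 1#) + - b              ≡⟨ +-assoc (1# + a) (- 1#) (- b) ⟩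
    (1# + a) + (- 1# + - b)              ≡⟨ cong ((1# + a) +_) (⁻¹-∙-comm 1# b) ⟩
    (1# + a) + - (1# + b)                ≡⟨ cong₂ (λ a′ b′ → a′ + - b′) (sym (1+× m 1#)) (sym (1+× n 1#)) ⟩
    suc m times 1# + - (suc n times 1#)  ∎
    where
    open ≡-Reasoning
    a = m times 1#
    b = n times 1#

  fromℤ-+-homo : ∀ i j → fromℤ (i ℤ.+ j) ≡ fromℤ i + fromℤ j
  fromℤ-+-homo (ℤ.+ m)    (ℤ.+ n)    = ×-homo-+ 1# m n
  fromℤ-+-homo (ℤ.+ m)    ℤ.-[1+ n ] = fromℤ-⊖ m (suc n)
  fromℤ-+-homo ℤ.-[1+ m ] (ℤ.+ n)    = trans (fromℤ-⊖ n (suc m)) (+-comm _ _)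
  fromℤ-+-homo ℤ.-[1+ m ] ℤ.-[1+ n ] = begin
    - (suc (suc (m ℕ.+ n)) times 1#)         ≡⟨ cong (λ k → - (k times 1#)) (sym (ℕ.+-suc (suc m) n)) ⟩
    - ((suc m ℕ.+ suc n) times 1#)           ≡⟨ cong -_ (×-homo-+ 1# (suc m) (suc n)) ⟩
    - (suc m times 1# + suc n times 1#)      ≡⟨ sym (⁻¹-∙-comm _ _) ⟩
    - (suc m times 1#) + - (suc n times 1#)  ∎
    where open ≡-Reasoning

  private
    fromℤ-+-*-homo : ∀ m j → fromℤ (ℤ.+ m ℤ.* j) ≡ fromℤ (ℤ.+ m) * fromℤ j
    fromℤ-+-*-homo m (ℤ.+ n) = trans (cong fromℤ (sym (ℤ.pos-* m n))) (×1-homo-* m n)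
    fromℤ-+-*-homo m ℤ.-[1+ n ] = begin
      fromℤ (ℤ.+ m ℤ.* ℤ.- ℤ.+[1+ n ])        ≡⟨ cong fromℤ (sym (ℤ.neg-distribʳ-* (ℤ.+ m) ℤ.+[1+ n ])) ⟩
      fromℤ (ℤ.- (ℤ.+ m ℤ.* ℤ.+[1+ n ]))      ≡⟨ fromℤ-‿homo (ℤ.+ m ℤ.* ℤ.+[1+ n ]) ⟩
      - fromℤ (ℤ.+ m ℤ.* ℤ.+[1+ n ])          ≡⟨ cong -_ (fromℤ-+-*-homo m ℤ.+[1+ n ]) ⟩
      - (fromℤ (ℤ.+ m) * fromℤ ℤ.+[1+ n ])    ≡⟨ -‿distribʳ-* _ _ ⟩
      fromℤ (ℤ.+ m) * - fromℤ ℤ.+[1+ n ]      ∎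
      where open ≡-Reasoning

  fromℤ-*-homo : ∀ i j → fromℤ (i ℤ.* j) ≡ fromℤ i * fromℤ j
  fromℤ-*-homo (ℤ.+ m) j = fromℤ-+-*-homo m j
  fromℤ-*-homo ℤ.-[1+ m ] j = begin
    fromℤ (ℤ.- ℤ.+[1+ m ] ℤ.* j)          ≡⟨ cong fromℤ (sym (ℤ.neg-distribˡ-* ℤ.+[1+ m ] j)) ⟩
    fromℤ (ℤ.- (ℤ.+[1+ m ] ℤ.* j))        ≡⟨ fromℤ-‿homo (ℤ.+[1+ m ] ℤ.* j) ⟩
    - fromℤ (ℤ.+[1+ m ] ℤ.* j)            ≡⟨ cong -_ (fromℤ-+-*-homo (suc m) j) ⟩
    - (fromℤ ℤ.+[1+ m ] * fromℤ j)        ≡⟨ -‿distribˡ-* _ _ ⟩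
    - fromℤ ℤ.+[1+ m ] * fromℤ j          ∎
    where open ≡-Reasoning

  ℤ⟶K : ℤ.+-*-rawRing -Raw-AlmostCommutative⟶ fromCommutativeRing commutativeRing
  ℤ⟶K = record
    { ⟦_⟧ = fromℤ ; +-homo = fromℤ-+-homo ; *-homo = fromℤ-*-homo ; -‿homo = fromℤ-‿homo
    ; 0-homo = refl ; 1-homo = refl }

  _≟fromℤ_ : ∀ i j → Maybe (fromℤ i ≡ fromℤ j)
  i ≟fromℤ j with i ℤ.≟ j
  ... | yes refl = just refl
  ... | no  _    = nothing

  open import Algebra.Solver.Ring ℤ.+-*-rawRing (fromCommutativeRing commutativeRing) ℤ⟶K _≟fromℤ_ public
    using (solve; _:=_; _:+_; _:*_; :-_; _:-_; con)

-- Finite fields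

module FiniteFieldProperties (K : FiniteField) where
  open FiniteField K
  open RingSolver K public using (commutativeRing; solve; _:=_; _:+_; _:*_; :-_; _:-_; con)
  open CommutativeRing commutativeRing
    using ( *-comm; *-identityˡ; +-identityʳ; zeroʳ; *-isCommutativeMonoid; +-isCommutativeMonoid; +-monoid
          ; semiring; commutativeSemiring)
  open import Algebra.Properties.Semiring.Exp semiring public using (_^_; ^-assocʳ)
  open import Algebra.Properties.CommutativeSemiring.Exp commutativeSemiring public using (^-distrib-*)
  open import Algebra.Properties.Monoid.Mult +-monoid using (×-assocˡ) renaming (_×_ to _times_)

  x-y≡0⇒x≡y : ∀ {x y} → x + - y ≡ 0# → x ≡ y
  x-y≡0⇒x≡y {x} {y} x-y≡0 = begin
    x              ≡⟨ solve 2 (λ x y → x := (x :- y) :+ y) refl x y ⟩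
    (x + - y) + y  ≡⟨ cong (_+ y) x-y≡0 ⟩
    0# + y         ≡⟨ solve 1 (λ y → con 0ℤ :+ y := y) refl y ⟩
    y              ∎
    where open ≡-Reasoning

  x+y≡y⇒x≡0 : ∀ {x y} → x + y ≡ y → x ≡ 0#
  x+y≡y⇒x≡0 {x} {y} x+y≡y = x-y≡0⇒x≡y (begin
    x + - 0#            ≡⟨ solve 2 (λ x y → x :- con 0ℤ := (x :+ y) :- y) refl x y ⟩
    (x + y) + - y       ≡⟨ cong (_+ - y) x+y≡y ⟩
    y + - y             ≡⟨ solve 1 (λ y → y :- y := con 0ℤ) refl y ⟩
    0#                  ∎)
    where open ≡-Reasoning

  -‿injective : ∀ {x y} → - x ≡ - y → x ≡ y
  -‿injective {x} {y} -x≡-y = trans (solve 1 (λ x → x := :- (:- x)) refl x)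
    (trans (cong -_ -x≡-y) (solve 1 (λ y → :- (:- y) := y) refl y))

  -‿≢0 : ∀ {x} → x ≢ 0# → - x ≢ 0#
  -‿≢0 {x} x≢0 -x≡0 = x≢0 (begin
    x        ≡⟨ solve 1 (λ x → x := :- (:- x)) refl x ⟩
    - (- x)  ≡⟨ cong -_ -x≡0 ⟩
    - 0#     ≡⟨ solve 0 (:- con 0ℤ := con 0ℤ) refl ⟩
    0#       ∎)
    where open ≡-Reasoning

  -- Junk value: 0# ⁻¹ = 0#.
  _⁻¹ : Carrier → Carrier
  x ⁻¹ with x ≟ 0#
  ... | yes _   = 0#
  ... | no  x≢0 = proj₁ (inverse x x≢0)

  x*x⁻¹≡1 : ∀ {x} → x ≢ 0# → x * x ⁻¹ ≡ 1#
  x*x⁻¹≡1 {x} x≢0 with x ≟ 0#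
  ... | yes x≡0 = contradiction x≡0 x≢0
  ... | no  x≢0 = proj₂ (inverse x x≢0)

  x*y≡0⇒x≡0⊎y≡0 : ∀ {x y} → x * y ≡ 0# → x ≡ 0# ⊎ y ≡ 0#
  x*y≡0⇒x≡0⊎y≡0 {x} {y} xy≡0 with x ≟ 0#
  ... | yes x≡0 = inj₁ x≡0
  ... | no  x≢0 = inj₂ (begin
    y                ≡⟨ sym (*-identityˡ y) ⟩
    1# * y           ≡⟨ cong (_* y) (sym (x*x⁻¹≡1 x≢0)) ⟩
    (x * x ⁻¹) * y   ≡⟨ solve 3 (λ x x⁻¹ y → (x :* x⁻¹) :* y := x⁻¹ :* (x :* y)) refl x (x ⁻¹) y ⟩
    x ⁻¹ * (x * y)   ≡⟨ cong (x ⁻¹ *_) xy≡0 ⟩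
    x ⁻¹ * 0#        ≡⟨ zeroʳ (x ⁻¹) ⟩
    0#               ∎)
    where open ≡-Reasoning

  *-≢0 : ∀ {x y} → x ≢ 0# → y ≢ 0# → x * y ≢ 0#
  *-≢0 x≢0 y≢0 xy≡0 with x*y≡0⇒x≡0⊎y≡0 xy≡0
  ... | inj₁ x≡0 = x≢0 x≡0
  ... | inj₂ y≡0 = y≢0 y≡0

  ^-≢0 : ∀ {x} n → x ≢ 0# → x ^ n ≢ 0#
  ^-≢0 zero    x≢0 = 0≢1 ∘′ sym
  ^-≢0 (suc n) x≢0 = *-≢0 x≢0 (^-≢0 n x≢0)

  ⁻¹-≢0 : ∀ {x} → x ≢ 0# → x ⁻¹ ≢ 0#
  ⁻¹-≢0 {x} x≢0 x⁻¹≡0 = 0≢1 (trans (sym (zeroʳ x)) (trans (cong (x *_) (sym x⁻¹≡0)) (x*x⁻¹≡1 x≢0)))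

  *-cancelˡ : ∀ {x y z} → x ≢ 0# → x * y ≡ x * z → y ≡ z
  *-cancelˡ {x} {y} {z} x≢0 xy≡xz with x*y≡0⇒x≡0⊎y≡0 x[y-z]≡0
    where
    x[y-z]≡0 : x * (y + - z) ≡ 0#
    x[y-z]≡0 = trans (solve 3 (λ x y z → x :* (y :- z) := x :* y :- x :* z) refl x y z)
                     (trans (cong (λ w → w + - (x * z)) xy≡xz) (solve 1 (λ w → w :- w := con 0ℤ) refl (x * z)))
  ... | inj₁ x≡0   = contradiction x≡0 x≢0
  ... | inj₂ y-z≡0 = x-y≡0⇒x≡y y-z≡0

  *-cancelʳ : ∀ {x y z} → z ≢ 0# → x * z ≡ y * z → x ≡ y
  *-cancelʳ {x} {y} {z} z≢0 xz≡yz = *-cancelˡ z≢0 (trans (*-comm z x) (trans xz≡yz (*-comm y z)))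

  1^n≡1 : ∀ n → 1# ^ n ≡ 1#
  1^n≡1 zero    = refl
  1^n≡1 (suc n) = trans (cong (1# *_) (1^n≡1 n)) (*-identityˡ 1#)

  foldr-*-≢0 : ∀ {xs} → All (_≢ 0#) xs → foldr _*_ 1# xs ≢ 0#
  foldr-*-≢0 []            = 0≢1 ∘′ sym
  foldr-*-≢0 (x≢0 ∷ xs≢0) = *-≢0 x≢0 (foldr-*-≢0 xs≢0)

  units : List Carrier
  units = filter (λ x → ¬? (x ≟ 0#)) elements

  units-unique : Unique units
  units-unique = Unique.filter⁺ (λ x → ¬? (x ≟ 0#)) unique

  ∈-units⁺ : ∀ {x} → x ≢ 0# → x ∈ units
  ∈-units⁺ {x} x≢0 = ∈-filter⁺ (λ x → ¬? (x ≟ 0#)) (complete x) x≢0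

  ∈-units⁻ : ∀ {x} → x ∈ units → x ≢ 0#
  ∈-units⁻ x∈ = proj₂ (∈-filter⁻ (λ x → ¬? (x ≟ 0#)) {xs = elements} x∈)

  length-units : suc (length units) ≡ order
  length-units = sym (↭-length (unique-⇔⇒↭ unique (0∉units ∷ units-unique) (mk⇔ split (λ _ → complete _))))
    where
    0∉units : All (0# ≢_) units
    0∉units = All.tabulate λ x∈ 0≡x → ∈-units⁻ x∈ (sym 0≡x)
    split : ∀ {x} → x ∈ elements → x ∈ 0# ∷ units
    split {x} _ with x ≟ 0#
    ... | yes x≡0 = here x≡0
    ... | no  x≢0 = there (∈-units⁺ x≢0)

  0<length-units : 0 < length units
  0<length-units = ⊆⇒length≤ {xs = [ 1# ]} ([] ∷ []) λ { (here refl) → ∈-units⁺ (0≢1 ∘′ sym) }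

  -- Lagrange for the unit group: multiplying by x permutes the units.
  x^[q-1]≡1 : ∀ {x} → x ≢ 0# → x ^ length units ≡ 1#
  x^[q-1]≡1 {x} x≢0 = *-cancelʳ (foldr-*-≢0 (All.tabulate ∈-units⁻))
    (trans (foldr-translation-invariant *-isCommutativeMonoid x x·units↭units) (sym (*-identityˡ _)))
    where
    x·units↭units : map (x *_) units ↭ units
    x·units↭units = unique-⇔⇒↭ (unique-map⁺ (x *_) units-unique (λ _ _ → *-cancelˡ x≢0)) units-unique
      (mk⇔ into onto)
      where
      into : ∀ {y} → y ∈ map (x *_) units → y ∈ units
      into y∈ with ∈-map⁻ (x *_) y∈
      ... | z , z∈units , refl = ∈-units⁺ (*-≢0 x≢0 (∈-units⁻ z∈units))
      onto : ∀ {y} → y ∈ units → y ∈ map (x *_) units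
      onto {y} y∈units = subst (_∈ map (x *_) units) x[x⁻¹y]≡y
        (∈-map⁺ (x *_) (∈-units⁺ (*-≢0 (⁻¹-≢0 x≢0) (∈-units⁻ y∈units))))
        where
        x[x⁻¹y]≡y : x * (x ⁻¹ * y) ≡ y
        x[x⁻¹y]≡y = trans (solve 3 (λ x x⁻¹ y → x :* (x⁻¹ :* y) := (x :* x⁻¹) :* y) refl x (x ⁻¹) y)
                          (trans (cong (_* y) (x*x⁻¹≡1 x≢0)) (*-identityˡ y))

  -- Lagrange for the additive group: adding 1# permutes the elements.
  order-times-1≡0 : order times 1# ≡ 0#
  order-times-1≡0 = x+y≡y⇒x≡0 (foldr-translation-invariant +-isCommutativeMonoid 1# 1+elements↭elements)
    where
    1+elements↭elements : map (1# +_) elements ↭ elements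
    1+elements↭elements = unique-⇔⇒↭ (unique-map⁺ (1# +_) unique (λ _ _ → +-cancelˡ)) unique
      (mk⇔ (λ _ → complete _) onto)
      where
      +-cancelˡ : ∀ {y z} → 1# + y ≡ 1# + z → y ≡ z
      +-cancelˡ {y} {z} 1+y≡1+z = x-y≡0⇒x≡y (trans (solve 2 (λ y z → y :- z := (con 1ℤ :+ y) :- (con 1ℤ :+ z)) refl y z)
        (trans (cong (_+ - (1# + z)) 1+y≡1+z) (solve 1 (λ w → w :- w := con 0ℤ) refl (1# + z))))
      onto : ∀ {y} → y ∈ elements → y ∈ map (1# +_) elements
      onto {y} _ = subst (_∈ map (1# +_) elements) (solve 1 (λ y → con 1ℤ :+ (y :- con 1ℤ) := y) refl y)
        (∈-map⁺ (1# +_) (complete (y + - 1#)))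

  odd-order⇒2≢0 : ¬ 2 ∣ order → 1# + 1# ≢ 0#
  odd-order⇒2≢0 odd 2≡0 with ¬2∣n⇒2∣1+n odd
  ... | divides j 1+q≡j*2 = 0≢1 (sym (begin
    1#                             ≡⟨ sym (+-identityʳ 1#) ⟩
    1# + 0#                        ≡⟨ cong (1# +_) (sym order-times-1≡0) ⟩
    suc order times 1#             ≡⟨ cong (_times 1#) 1+q≡j*2 ⟩
    (j ℕ.* 2) times 1#             ≡⟨ sym (×-assocˡ 1# j 2) ⟩
    j times (1# + (1# + 0#))       ≡⟨ cong (λ z → j times (1# + z)) (+-identityʳ 1#) ⟩
    j times (1# + 1#)              ≡⟨ cong (j times_) 2≡0 ⟩
    j times 0#                     ≡⟨ times-0# j ⟩
    0#                             ∎))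
    where
    open ≡-Reasoning
    times-0# : ∀ n → n times 0# ≡ 0#
    times-0# zero    = refl
    times-0# (suc n) = trans (cong (0# +_) (times-0# n)) (+-identityʳ 0#)

  eval : List Carrier → Carrier → Carrier
  eval []       x = 0#
  eval (a ∷ as) x = a + x * eval as x

  -- The quotient of a ∷ as by X - r, for any constant term a.
  quotient : Carrier → List Carrier → List Carrier
  quotient r []       = []
  quotient r (b ∷ bs) = eval (b ∷ bs) r ∷ quotient r bs

  length-quotient : ∀ r as → length (quotient r as) ≡ length as
  length-quotient r []       = refl
  length-quotient r (b ∷ bs) = cong suc (length-quotient r bs)

  eval-quotient : ∀ r a as x → eval (a ∷ as) x ≡ (x + - r) * eval (quotient r as) x + eval (a ∷ as) r
  eval-quotient r a []       x = solve 3 (λ a x r → a :+ x :* con 0ℤ := (x :- r) :* con 0ℤ :+ (a :+ r :* con 0ℤ)) refl a x r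
  eval-quotient r a (b ∷ bs) x = trans (cong (λ v → a + x * v) (eval-quotient r b bs x))
    (solve 5 (λ a x r q e → a :+ x :* ((x :- r) :* q :+ e) := (x :- r) :* (e :+ x :* q) :+ (a :+ r :* e))
           refl a x r (eval (quotient r bs) x) (eval (b ∷ bs) r))

  roots<length : ∀ {rs} p → (∃[ x ] eval p x ≢ 0#) → Unique rs → All (λ r → eval p r ≡ 0#) rs →
                 length rs < length p
  roots<length {rs}     []       (x , 0≢0) _ _ = contradiction refl 0≢0
  roots<length {[]}     (a ∷ as) _ _ _ = s≤s z≤n
  roots<length {r ∷ rs} (a ∷ as) (x , px≢0) (r∉rs ∷ rs!) (pr≡0 ∷ prs≡0) =
    s≤s (subst (length rs <_) (length-quotient r as) (roots<length (quotient r as) (x , qx≢0) rs! qrs≡0))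
    where
    factor : ∀ y → eval (a ∷ as) y ≡ (y + - r) * eval (quotient r as) y
    factor y = trans (eval-quotient r a as y) (trans (cong ((y + - r) * eval (quotient r as) y +_) pr≡0) (+-identityʳ _))
    qx≢0 : eval (quotient r as) x ≢ 0#
    qx≢0 qx≡0 = px≢0 (trans (factor x) (trans (cong (_ *_) qx≡0) (zeroʳ _)))
    qrs≡0 : All (λ s → eval (quotient r as) s ≡ 0#) rs
    qrs≡0 = All.tabulate λ {s} s∈rs → case x*y≡0⇒x≡0⊎y≡0 (trans (sym (factor s)) (All.lookup prs≡0 s∈rs)) of λ where
      (inj₁ s-r≡0) → contradiction (sym (x-y≡0⇒x≡y s-r≡0)) (All.lookup r∉rs s∈rs)
      (inj₂ qs≡0)  → qs≡0

  xⁿ≡a-roots≤n : ∀ {n a rs} → 0 < n → a ≢ 0# → Unique rs → All (λ r → r ^ n ≡ a) rs → length rs ≤ n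
  xⁿ≡a-roots≤n {suc n} {a} {rs} _ a≢0 rs! rⁿ≡a = ℕ.≤-pred (subst (length rs <_) length-p
    (roots<length p (0# , p0≢0) rs! (All.map root rⁿ≡a)))
    where
    monomial : List Carrier
    monomial = replicate n 0# ++ [ 1# ]
    eval-monomial : ∀ k x → eval (replicate k 0# ++ [ 1# ]) x ≡ x ^ k
    eval-monomial zero    x = solve 1 (λ x → con 1ℤ :+ x :* con 0ℤ := con 1ℤ) refl x
    eval-monomial (suc k) x = trans (cong (λ v → 0# + x * v) (eval-monomial k x)) (solve 1 (λ v → con 0ℤ :+ v := v) refl _)
    p : List Carrier
    p = - a ∷ monomial
    length-p : length p ≡ suc (suc n)
    length-p = cong suc (trans (length-++ (replicate n 0#)) (trans (cong (ℕ._+ 1) (length-replicate n)) (ℕ.+-comm n 1)))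
    root : ∀ {r} → r ^ suc n ≡ a → eval p r ≡ 0#
    root {r} rⁿ≡a = begin
      - a + r * eval monomial r  ≡⟨ cong (λ v → - a + r * v) (eval-monomial n r) ⟩
      - a + r ^ suc n            ≡⟨ cong (- a +_) rⁿ≡a ⟩
      - a + a                    ≡⟨ solve 1 (λ a → :- a :+ a := con 0ℤ) refl a ⟩
      0#                         ∎
      where open ≡-Reasoning
    p0≢0 : eval p 0# ≢ 0#
    p0≢0 p0≡0 = -‿≢0 a≢0 (trans (solve 2 (λ a v → :- a := :- a :+ con 0ℤ :* v) refl a _) p0≡0)

  IsPower : ℕ → Carrier → Set
  IsPower m y = ∃[ z ] (z ≢ 0# × z ^ m ≡ y)

  isPower? : ∀ m y → Dec (IsPower m y)
  isPower? m y with any? (λ z → ¬? (z ≟ 0#) ×-dec ((z ^ m) ≟ y)) elements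
  ... | yes witness = yes (Any.satisfied witness)
  ... | no  none    = no λ { (z , power) → none (lose (complete z) power) }

  isPower-* : ∀ {m x y} → IsPower m x → IsPower m y → IsPower m (x * y)
  isPower-* {m} (z , z≢0 , refl) (w , w≢0 , refl) = z * w , *-≢0 z≢0 w≢0 , ^-distrib-* z w m

  -- Euler's criterion: if m ∣ q - 1, the m-th powers are exactly the roots of X^((q-1)/m) - 1.
  module PowerResidues (m e : ℕ) (units≡e*m : length units ≡ e ℕ.* m) where

    private instance
      e*m≢0 : NonZero (e ℕ.* m)
      e*m≢0 = ℕ.>-nonZero (subst (0 <_) units≡e*m 0<length-units)
      e≢0 : NonZero e
      e≢0 = ℕ.m*n≢0⇒m≢0 e
      m≢0 : NonZero m
      m≢0 = ℕ.m*n≢0⇒n≢0 e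

    powers : List Carrier
    powers = filter (isPower? m) units

    powers-unique : Unique powers
    powers-unique = Unique.filter⁺ (isPower? m) units-unique

    ∈-powers⁺ : ∀ {y} → y ≢ 0# → IsPower m y → y ∈ powers
    ∈-powers⁺ y≢0 power = ∈-filter⁺ (isPower? m) (∈-units⁺ y≢0) power

    ∈-powers⁻ : ∀ {y} → y ∈ powers → y ≢ 0# × IsPower m y
    ∈-powers⁻ y∈ with ∈-filter⁻ (isPower? m) {xs = units} y∈
    ... | y∈units , power = ∈-units⁻ y∈units , power

    isPower⇒^e≡1 : ∀ {y} → IsPower m y → y ^ e ≡ 1#
    isPower⇒^e≡1 (z , z≢0 , refl) = begin
      (z ^ m) ^ e       ≡⟨ ^-assocʳ z m e ⟩
      z ^ (m ℕ.* e)     ≡⟨ cong (z ^_) (trans (ℕ.*-comm m e) (sym units≡e*m)) ⟩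
      z ^ length units  ≡⟨ x^[q-1]≡1 z≢0 ⟩
      1#                ∎
      where open ≡-Reasoning

    ^e≡1-roots≤e : ∀ {rs} → Unique rs → All (λ r → r ^ e ≡ 1#) rs → length rs ≤ e
    ^e≡1-roots≤e = xⁿ≡a-roots≤n (ℕ.>-nonZero⁻¹ e) (0≢1 ∘′ sym)

    length-powers≤e : length powers ≤ e
    length-powers≤e = ^e≡1-roots≤e powers-unique
      (All.tabulate (isPower⇒^e≡1 ∘′ proj₂ ∘′ ∈-powers⁻))

    private
      kernel : List Carrier
      kernel = filter (λ x → (x ^ m) ≟ 1#) units

      length-kernel≤m : length kernel ≤ m
      length-kernel≤m = xⁿ≡a-roots≤n (ℕ.>-nonZero⁻¹ m) (0≢1 ∘′ sym) (Unique.filter⁺ (λ x → (x ^ m) ≟ 1#) units-unique)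
        (All.tabulate (proj₂ ∘′ ∈-filter⁻ (λ x → (x ^ m) ≟ 1#) {xs = units}))

      root : Carrier → Carrier
      root y with isPower? m y
      ... | yes (z , _) = z
      ... | no  _       = 1#

      root-≢0 : ∀ y → root y ≢ 0#
      root-≢0 y with isPower? m y
      ... | yes (_ , z≢0 , _) = z≢0
      ... | no  _             = 0≢1 ∘′ sym

      root-^ : ∀ {y} → IsPower m y → root y ^ m ≡ y
      root-^ {y} power with isPower? m y
      ... | yes (_ , _ , zᵐ≡y) = zᵐ≡y
      ... | no  ¬power         = contradiction power ¬power

      -- g ↦ (gᵐ , g / ᵐ√(gᵐ)) is injective, so the m-th power map has fibres of size at most |kernel| ≤ m.
      split : Carrier → Carrier × Carrier
      split g = g ^ m , g * root (g ^ m) ⁻¹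

      split-injective : ∀ {g h} → split g ≡ split h → g ≡ h
      split-injective {g} {h} eq = *-cancelʳ (⁻¹-≢0 (root-≢0 (g ^ m)))
        (trans (cong proj₂ eq) (cong (λ y → h * root y ⁻¹) (sym (cong proj₁ eq))))

      split-into : ∀ {g} → g ∈ units → split g ∈ cartesianProduct powers kernel
      split-into {g} g∈units = ∈-cartesianProduct⁺
        (∈-powers⁺ (^-≢0 m g≢0) (g , g≢0 , refl))
        (∈-filter⁺ (λ x → (x ^ m) ≟ 1#) (∈-units⁺ (*-≢0 g≢0 (⁻¹-≢0 (root-≢0 (g ^ m))))) [g/r]ᵐ≡1)
        where
        g≢0 = ∈-units⁻ g∈units
        r = root (g ^ m)
        [g/r]ᵐ≡1 : (g * r ⁻¹) ^ m ≡ 1#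
        [g/r]ᵐ≡1 = begin
          (g * r ⁻¹) ^ m        ≡⟨ ^-distrib-* g (r ⁻¹) m ⟩
          g ^ m * r ⁻¹ ^ m      ≡⟨ cong (_* r ⁻¹ ^ m) (sym (root-^ (g , g≢0 , refl))) ⟩
          r ^ m * r ⁻¹ ^ m      ≡⟨ sym (^-distrib-* r (r ⁻¹) m) ⟩
          (r * r ⁻¹) ^ m        ≡⟨ cong (_^ m) (x*x⁻¹≡1 (root-≢0 (g ^ m))) ⟩
          1# ^ m                ≡⟨ 1^n≡1 m ⟩
          1#                    ∎
          where open ≡-Reasoning

    e≤length-powers : e ≤ length powers
    e≤length-powers = ℕ.*-cancelʳ-≤ e (length powers) m (begin
      e ℕ.* m                                  ≡⟨ sym units≡e*m ⟩
      length units                             ≤⟨ injection⇒length≤ split units-unique (λ _ _ → split-injective) split-into ⟩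
      length (cartesianProduct powers kernel)  ≡⟨ length-cartesianProduct powers kernel ⟩
      length powers ℕ.* length kernel          ≤⟨ ℕ.*-monoʳ-≤ (length powers) length-kernel≤m ⟩
      length powers ℕ.* m                      ∎)
      where open ℕ.≤-Reasoning

    length-powers : length powers ≡ e
    length-powers = ℕ.≤-antisym length-powers≤e e≤length-powers

    ^e≡1⇒isPower : ∀ {y} → y ≢ 0# → y ^ e ≡ 1# → IsPower m y
    ^e≡1⇒isPower {y} y≢0 yᵉ≡1 with isPower? m y
    ... | yes power = power
    ... | no  ¬power = contradiction (subst (λ n → suc n ≤ e) length-powers more-than-e-roots) (ℕ.<-irrefl refl)
      where
      more-than-e-roots : suc (length powers) ≤ e
      more-than-e-roots = ^e≡1-roots≤e
        (All.tabulate (λ z∈ y≡z → ¬power (subst (IsPower m) (sym y≡z) (proj₂ (∈-powers⁻ z∈)))) ∷ powers-unique)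
        (yᵉ≡1 ∷ All.tabulate (isPower⇒^e≡1 ∘′ proj₂ ∘′ ∈-powers⁻))

-- The quadratic extension F_q² = F_q(α), α² = d

module QuadraticExtension (F : FiniteField) (d : FiniteField.Carrier F) (d-nonsquare : IsNonSquare F d) where
  open FiniteField F
  open FiniteFieldProperties F
  open QuadExt F d hiding (_^_; IsPower)
  module Q = QuadExt F d

  pair : ∀ {a a′ b b′ : Carrier} → a ≡ a′ → b ≡ b′ → (a , b) ≡ (a′ , b′)
  pair = cong₂ _,_

  Fq²-isCommutativeRing : IsCommutativeRing _≡_ _⊕_ _⊗_ (λ u → ⊖ u) 0² 1²
  Fq²-isCommutativeRing = record
    { isRing = record
      { +-isAbelianGroup = record
        { isGroup = record
          { isMonoid = record
            { isSemigroup = record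
              { isMagma = record { isEquivalence = isEquivalence ; ∙-cong = cong₂ _⊕_ }
              ; assoc = λ { (a , b) (c , e) (f , g) →
                  pair (solve 3 (λ x y z → (x :+ y) :+ z := x :+ (y :+ z)) refl a c f)
                       (solve 3 (λ x y z → (x :+ y) :+ z := x :+ (y :+ z)) refl b e g) } }
            ; identity =
                (λ { (a , b) → pair (solve 1 (λ x → con 0ℤ :+ x := x) refl a) (solve 1 (λ x → con 0ℤ :+ x := x) refl b) }) ,
                (λ { (a , b) → pair (solve 1 (λ x → x :+ con 0ℤ := x) refl a) (solve 1 (λ x → x :+ con 0ℤ := x) refl b) }) }
          ; inverse =
              (λ { (a , b) → pair (solve 1 (λ x → :- x :+ x := con 0ℤ) refl a) (solve 1 (λ x → :- x :+ x := con 0ℤ) refl b) }) ,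
              (λ { (a , b) → pair (solve 1 (λ x → x :- x := con 0ℤ) refl a) (solve 1 (λ x → x :- x := con 0ℤ) refl b) })
          ; ⁻¹-cong = cong (λ u → ⊖ u) }
        ; comm = λ { (a , b) (c , e) →
            pair (solve 2 (λ x y → x :+ y := y :+ x) refl a c) (solve 2 (λ x y → x :+ y := y :+ x) refl b e) } }
      ; *-cong = cong₂ _⊗_
      ; *-assoc = λ { (a , b) (c , e) (f , g) → pair
          (solve 7 (λ a b c e f g d → (a :* c :+ d :* (b :* e)) :* f :+ d :* ((a :* e :+ b :* c) :* g)
                                      := a :* (c :* f :+ d :* (e :* g)) :+ d :* (b :* (c :* g :+ e :* f))) refl a b c e f g d)
          (solve 7 (λ a b c e f g d → (a :* c :+ d :* (b :* e)) :* g :+ (a :* e :+ b :* c) :* f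
                                      := a :* (c :* g :+ e :* f) :+ b :* (c :* f :+ d :* (e :* g))) refl a b c e f g d) }
      ; *-identity =
          (λ { (a , b) → pair (solve 3 (λ a b d → con 1ℤ :* a :+ d :* (con 0ℤ :* b) := a) refl a b d)
                              (solve 2 (λ a b → con 1ℤ :* b :+ con 0ℤ :* a := b) refl a b) }) ,
          (λ { (a , b) → pair (solve 3 (λ a b d → a :* con 1ℤ :+ d :* (b :* con 0ℤ) := a) refl a b d)
                              (solve 2 (λ a b → a :* con 0ℤ :+ b :* con 1ℤ := b) refl a b) })
      ; distrib =
          (λ { (a , b) (c , e) (f , g) → pair
            (solve 7 (λ a b c e f g d → a :* (c :+ f) :+ d :* (b :* (e :+ g))
                                        := (a :* c :+ d :* (b :* e)) :+ (a :* f :+ d :* (b :* g))) refl a b c e f g d)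
            (solve 6 (λ a b c e f g → a :* (e :+ g) :+ b :* (c :+ f) := (a :* e :+ b :* c) :+ (a :* g :+ b :* f)) refl a b c e f g) }) ,
          (λ { (a , b) (c , e) (f , g) → pair
            (solve 7 (λ a b c e f g d → (c :+ f) :* a :+ d :* ((e :+ g) :* b)
                                        := (c :* a :+ d :* (e :* b)) :+ (f :* a :+ d :* (g :* b))) refl a b c e f g d)
            (solve 6 (λ a b c e f g → (c :+ f) :* b :+ (e :+ g) :* a := (c :* b :+ e :* a) :+ (f :* b :+ g :* a)) refl a b c e f g) }) }
    ; *-comm = λ { (a , b) (c , e) → pair
        (solve 5 (λ a b c e d → a :* c :+ d :* (b :* e) := c :* a :+ d :* (e :* b)) refl a b c e d)
        (solve 4 (λ a b c e → a :* e :+ b :* c := c :* b :+ e :* a) refl a b c e) } }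

  norm : Fq² → Carrier
  norm (a , b) = a * a + - (d * (b * b))

  -- A nonzero element of norm 0 would exhibit d as the square (a / b)².
  norm≢0 : ∀ {u} → u ≢ 0² → norm u ≢ 0#
  norm≢0 {a , b} u≢0 N≡0 with b ≟ 0#
  ... | yes refl = u≢0 (pair (reduce (x*y≡0⇒x≡0⊎y≡0
    (trans (solve 2 (λ a d → a :* a := a :* a :- d :* (con 0ℤ :* con 0ℤ)) refl a d) N≡0))) refl)
  ... | no b≢0 = proj₂ d-nonsquare (a * b ⁻¹) (begin
    (a * b ⁻¹) * (a * b ⁻¹)                       ≡⟨ solve 4 (λ a b i d → (a :* i) :* (a :* i)
                                                        := (a :* a :- d :* (b :* b)) :* (i :* i) :+ d :* ((b :* i) :* (b :* i)))
                                                        refl a b (b ⁻¹) d ⟩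
    norm (a , b) * (b ⁻¹ * b ⁻¹) + d * ((b * b ⁻¹) * (b * b ⁻¹))
                                                  ≡⟨ cong₂ (λ n u → n * (b ⁻¹ * b ⁻¹) + d * (u * u)) N≡0 (x*x⁻¹≡1 b≢0) ⟩
    0# * (b ⁻¹ * b ⁻¹) + d * (1# * 1#)            ≡⟨ solve 2 (λ i d → con 0ℤ :* (i :* i) :+ d :* (con 1ℤ :* con 1ℤ) := d) refl (b ⁻¹) d ⟩
    d                                             ∎)
    where open ≡-Reasoning

  Fq²-inverse : ∀ u → u ≢ 0² → ∃[ v ] (u ⊗ v ≡ 1²)
  Fq²-inverse (a , b) u≢0 = (a * N⁻¹ , - b * N⁻¹) , pair
    (trans (solve 4 (λ a b i d → a :* (a :* i) :+ d :* (b :* (:- b :* i)) := (a :* a :- d :* (b :* b)) :* i) refl a b N⁻¹ d)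
           (x*x⁻¹≡1 (norm≢0 u≢0)))
    (solve 3 (λ a b i → a :* (:- b :* i) :+ b :* (a :* i) := con 0ℤ) refl a b N⁻¹)
    where
    N⁻¹ = norm (a , b) ⁻¹

  Fq²-field : FiniteField
  Fq²-field = record
    { Carrier = Fq²
    ; _≟_ = ≡-dec _≟_ _≟_
    ; _+_ = _⊕_ ; _*_ = _⊗_ ; -_ = λ u → ⊖ u ; 0# = 0² ; 1# = 1²
    ; isCommutativeRing = Fq²-isCommutativeRing
    ; 0≢1 = 0≢1 ∘′ cong proj₁
    ; inverse = Fq²-inverse
    ; elements = cartesianProduct elements elements
    ; complete = λ (a , b) → ∈-cartesianProduct⁺ (complete a) (complete b)
    ; unique = Unique.cartesianProduct⁺ unique unique
    }

  order-Fq² : FiniteField.order Fq²-field ≡ order ℕ.* order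
  order-Fq² = length-cartesianProduct elements elements

  module Ext = FiniteFieldProperties Fq²-field

  ^-agrees : ∀ u n → u Q.^ n ≡ u Ext.^ n
  ^-agrees u zero    = refl
  ^-agrees u (suc n) = cong (u ⊗_) (^-agrees u n)

  isPower⇔ : ∀ {n u} → Q.IsPower n u ⇔ Ext.IsPower n u
  isPower⇔ {n} = mk⇔ (λ (z , z≢0 , zⁿ≡u) → z , z≢0 , trans (sym (^-agrees z n)) zⁿ≡u)
                     (λ (z , z≢0 , zⁿ≡u) → z , z≢0 , trans (^-agrees z n) zⁿ≡u)

  embed-⊗ : ∀ a b → embed a ⊗ embed b ≡ embed (a * b)
  embed-⊗ a b = pair (solve 3 (λ a b d → a :* b :+ d :* (con 0ℤ :* con 0ℤ) := a :* b) refl a b d)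
                     (solve 2 (λ a b → a :* con 0ℤ :+ con 0ℤ :* b := con 0ℤ) refl a b)

  embed-^ : ∀ t n → embed t Ext.^ n ≡ embed (t ^ n)
  embed-^ t zero    = refl
  embed-^ t (suc n) = trans (cong (embed t ⊗_) (embed-^ t n)) (embed-⊗ t (t ^ n))

  embed-≢0 : ∀ {t} → t ≢ 0# → embed t ≢ 0²
  embed-≢0 t≢0 = t≢0 ∘′ cong proj₁

  conj : Fq² → Fq²
  conj (a , b) = a , - b

  conj-⊗ : ∀ u v → conj (u ⊗ v) ≡ conj u ⊗ conj v
  conj-⊗ (a , b) (c , e) = pair
    (solve 5 (λ a b c e d → a :* c :+ d :* (b :* e) := a :* c :+ d :* (:- b :* :- e)) refl a b c e d)
    (solve 4 (λ a b c e → :- (a :* e :+ b :* c) := a :* :- e :+ :- b :* c) refl a b c e)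

  conj-^ : ∀ u n → conj (u Ext.^ n) ≡ conj u Ext.^ n
  conj-^ u zero    = pair refl (solve 0 (:- con 0ℤ := con 0ℤ) refl)
  conj-^ u (suc n) = trans (conj-⊗ u (u Ext.^ n)) (cong (conj u ⊗_) (conj-^ u n))

  conj-≢0 : ∀ {u} → u ≢ 0² → conj u ≢ 0²
  conj-≢0 {a , b} u≢0 conj≡0 = u≢0 (pair (cong proj₁ conj≡0)
    (-‿injective (trans (cong proj₂ conj≡0) (solve 0 (con 0ℤ := :- con 0ℤ) refl))))

  isPower-conj : ∀ {n u} → Ext.IsPower n u → Ext.IsPower n (conj u)
  isPower-conj {n} (z , z≢0 , refl) = conj z , conj-≢0 z≢0 , sym (conj-^ z n)

-- m-ary lines through α

module MaryLines
  (F : FiniteField) (d : FiniteField.Carrier F) (d-nonsquare : IsNonSquare F d)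
  (m k : ℕ) .{{_ : NonZero m}} (q+1≡k*m : suc (FiniteField.order F) ≡ k ℕ.* m)
  where
  open FiniteField F
  open FiniteFieldProperties F
  open QuadExt F d hiding (_^_; IsPower)
  open QuadraticExtension F d d-nonsquare

  e : ℕ
  e = length units ℕ.* k

  units²≡e*m : length Ext.units ≡ e ℕ.* m
  units²≡e*m = ℕ.suc-injective (begin
    suc (length Ext.units)       ≡⟨ Ext.length-units ⟩
    FiniteField.order Fq²-field  ≡⟨ order-Fq² ⟩
    order ℕ.* order              ≡⟨ cong₂ ℕ._*_ (sym length-units) (sym length-units) ⟩
    suc n ℕ.* suc n              ≡⟨ cong suc (sym (ℕ.*-suc n (suc n))) ⟩
    suc (n ℕ.* suc (suc n))      ≡⟨ cong (λ x → suc (n ℕ.* suc x)) length-units ⟩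
    suc (n ℕ.* suc order)        ≡⟨ cong (λ x → suc (n ℕ.* x)) q+1≡k*m ⟩
    suc (n ℕ.* (k ℕ.* m))        ≡⟨ cong suc (sym (ℕ.*-assoc n k m)) ⟩
    suc (e ℕ.* m)                ∎)
    where
    open ≡-Reasoning
    n = length units

  open Ext.PowerResidues m e units²≡e*m

  embed-isPower : ∀ {t} → t ≢ 0# → Ext.IsPower m (embed t)
  embed-isPower {t} t≢0 = ^e≡1⇒isPower (embed-≢0 t≢0) (begin
    embed t Ext.^ (length units ℕ.* k)        ≡⟨ sym (Ext.^-assocʳ (embed t) (length units) k) ⟩
    (embed t Ext.^ length units) Ext.^ k      ≡⟨ cong (Ext._^ k) (trans (embed-^ t (length units)) (cong embed (x^[q-1]≡1 t≢0))) ⟩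
    1² Ext.^ k                                ≡⟨ Ext.1^n≡1 k ⟩
    1²                                        ∎)
    where open ≡-Reasoning

  isPower-· : ∀ {t u} → t ≢ 0# → Ext.IsPower m u → Ext.IsPower m (t · u)
  isPower-· t≢0 = Ext.isPower-* {m} (embed-isPower t≢0)

  isPower-⊖ : ∀ {u} → Ext.IsPower m u → Ext.IsPower m (⊖ u)
  isPower-⊖ {a , b} power = subst (Ext.IsPower m)
    (pair (solve 3 (λ a b d → :- con 1ℤ :* a :+ d :* (con 0ℤ :* b) := :- a) refl a b d)
          (solve 2 (λ a b → :- con 1ℤ :* b :+ con 0ℤ :* a := :- b) refl a b))
    (isPower-· (-‿≢0 (0≢1 ∘′ sym)) power)

  embed-⊖-α : ∀ c → embed c ⊖ α ≡ (c , - 1#)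
  embed-⊖-α c = pair (solve 1 (λ c → c :- con 0ℤ := c) refl c) (solve 0 (con 0ℤ :- con 1ℤ := :- con 1ℤ) refl)

  -- The m-ary line through α with slope s meets F_q where t s₂ = -1; rescaling s by t gives c - α.
  isMeetPoint⇔ : ∀ {c} → IsMeetPoint m c ⇔ Ext.IsPower m (embed c ⊖ α)
  isMeetPoint⇔ {c} = mk⇔ to from
    where
    to : IsMeetPoint m c → Ext.IsPower m (embed c ⊖ α)
    to ((s₁ , s₂) , _ , s-power , _ , t , α+ts≡c) =
      subst (Ext.IsPower m) (sym (trans (embed-⊖-α c) c-α≡ts)) (isPower-· t≢0 (Equivalence.to isPower⇔ s-power))
      where
      first : 0# + (t * s₁ + d * (0# * s₂)) ≡ c
      first = cong proj₁ α+ts≡c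
      second : 1# + (t * s₂ + 0# * s₁) ≡ 0#
      second = cong proj₂ α+ts≡c
      t≢0 : t ≢ 0#
      t≢0 refl = 0≢1 (sym (trans (solve 2 (λ s₁ s₂ → con 1ℤ := con 1ℤ :+ (con 0ℤ :* s₂ :+ con 0ℤ :* s₁)) refl s₁ s₂)
                                 second))
      c-α≡ts : (c , - 1#) ≡ t · (s₁ , s₂)
      c-α≡ts = pair
        (trans (sym first) (solve 1 (λ x → con 0ℤ :+ x := x) refl _))
        (trans (solve 0 (:- con 1ℤ := :- con 1ℤ :+ con 0ℤ) refl) (trans (cong (λ z → - 1# + z) (sym second))
          (solve 3 (λ t s₁ s₂ → :- con 1ℤ :+ (con 1ℤ :+ (t :* s₂ :+ con 0ℤ :* s₁)) := t :* s₂ :+ con 0ℤ :* s₁) refl t s₁ s₂)))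
    from : Ext.IsPower m (embed c ⊖ α) → IsMeetPoint m c
    from power = embed c ⊖ α , embed-⊖-α-≢0 ∘′ cong proj₂ , Equivalence.from isPower⇔ power , embed-⊖-α-≢0 , 1# ,
      pair (solve 2 (λ c d → con 0ℤ :+ (con 1ℤ :* (c :- con 0ℤ) :+ d :* (con 0ℤ :* (con 0ℤ :- con 1ℤ))) := c) refl c d)
           (solve 1 (λ c → con 1ℤ :+ (con 1ℤ :* (con 0ℤ :- con 1ℤ) :+ con 0ℤ :* (c :- con 0ℤ)) := con 0ℤ) refl c)
      where
      embed-⊖-α-≢0 : 0# + - 1# ≢ 0#
      embed-⊖-α-≢0 = subst (_≢ 0#) (solve 0 (:- con 1ℤ := con 0ℤ :- con 1ℤ) refl) (-‿≢0 (0≢1 ∘′ sym))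

  adjacent : ∀ {x y} → x ≢ y → Ext.IsPower m (x ⊖ y) → Adj m x y
  adjacent x≢y power = x≢y , Equivalence.from isPower⇔ power

  adjacent-sym : ∀ {x y} → Adj m x y → Adj m y x
  adjacent-sym {a , b} {c , e} (x≢y , power) = adjacent (x≢y ∘′ sym) (subst (Ext.IsPower m)
    (pair (solve 2 (λ a c → :- (a :- c) := c :- a) refl a c) (solve 2 (λ b e → :- (b :- e) := e :- b) refl b e))
    (isPower-⊖ (Equivalence.to isPower⇔ power)))

  clique-∷ : ∀ {x ys} → (∀ {y} → y ∈ ys → Adj m x y) →
             IsClique m ys × Unique ys → IsClique m (x ∷ ys) × Unique (x ∷ ys)
  clique-∷ {x} {ys} x~ys (ys-clique , ys-unique) = clique , All.tabulate (proj₁ ∘′ x~ys) ∷ ys-unique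
    where
    clique : IsClique m (x ∷ ys)
    clique (here refl) (here refl) x≢x = contradiction refl x≢x
    clique (here refl) (there y∈)  _   = x~ys y∈
    clique (there y∈)  (here refl) _   = adjacent-sym (x~ys y∈)
    clique (there y∈)  (there z∈)  y≢z = ys-clique y∈ z∈ y≢z

  -- 2α squares to the scalar 4d, so its e-th power is a power of 4d^(q-1) = 1 once k is even.
  2α-isPower : 1# + 1# ≢ 0# → 2 ∣ k → Ext.IsPower m (0# , 1# + 1#)
  2α-isPower 2≢0 (divides j k≡j*2) = ^e≡1⇒isPower (2≢0 ∘′ cong proj₂) (begin
    2α Ext.^ e                                ≡⟨ cong (2α Ext.^_) e≡2*[n*j] ⟩
    2α Ext.^ (2 ℕ.* (n ℕ.* j))                ≡⟨ sym (Ext.^-assocʳ 2α 2 (n ℕ.* j)) ⟩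
    (2α Ext.^ 2) Ext.^ (n ℕ.* j)              ≡⟨ cong (Ext._^ (n ℕ.* j)) 2α²≡4d ⟩
    embed 4d Ext.^ (n ℕ.* j)                  ≡⟨ sym (Ext.^-assocʳ (embed 4d) n j) ⟩
    (embed 4d Ext.^ n) Ext.^ j                ≡⟨ cong (Ext._^ j) (trans (embed-^ 4d n) (cong embed (x^[q-1]≡1 4d≢0))) ⟩
    1² Ext.^ j                                ≡⟨ Ext.1^n≡1 j ⟩
    1²                                        ∎)
    where
    open ≡-Reasoning
    n = length units
    2α : Fq²
    2α = 0# , 1# + 1#
    4d = d * ((1# + 1#) * (1# + 1#))
    2α²≡4d : 2α Ext.^ 2 ≡ embed 4d
    2α²≡4d = pair
      (solve 2 (λ d t → con 0ℤ :* (con 0ℤ :* con 1ℤ :+ d :* (t :* con 0ℤ)) :+ d :* (t :* (con 0ℤ :* con 0ℤ :+ t :* con 1ℤ))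
                        := d :* (t :* t)) refl d (1# + 1#))
      (solve 2 (λ d t → con 0ℤ :* (con 0ℤ :* con 0ℤ :+ t :* con 1ℤ) :+ t :* (con 0ℤ :* con 1ℤ :+ d :* (t :* con 0ℤ))
                        := con 0ℤ) refl d (1# + 1#))
    4d≢0 : 4d ≢ 0#
    4d≢0 = *-≢0 (proj₁ d-nonsquare) (*-≢0 2≢0 2≢0)
    e≡2*[n*j] : e ≡ 2 ℕ.* (n ℕ.* j)
    e≡2*[n*j] = trans (cong (n ℕ.*_) k≡j*2) (trans (sym (ℕ.*-assoc n j 2)) (ℕ.*-comm (n ℕ.* j) 2))

  α~-α : 1# + 1# ≢ 0# → 2 ∣ k → Adj m α (⊖ α)
  α~-α 2≢0 2∣k = adjacent {α} {⊖ α} (2≢0 ∘′ 2≡0) (subst (Ext.IsPower m)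
    (pair (solve 0 (con 0ℤ := con 0ℤ :- (:- con 0ℤ)) refl) (solve 0 (con 1ℤ :+ con 1ℤ := con 1ℤ :- (:- con 1ℤ)) refl))
    (2α-isPower 2≢0 2∣k))
    where
    2≡0 : α ≡ ⊖ α → 1# + 1# ≡ 0#
    2≡0 α≡-α = trans (cong (1# +_) (cong proj₂ α≡-α)) (solve 0 (con 1ℤ :- con 1ℤ := con 0ℤ) refl)

  private
    horizontal? : (s : Fq²) → Dec (proj₂ s ≡ 0#)
    horizontal? s = proj₂ s ≟ 0#

  length-horizontal-powers : length (filter horizontal? powers) ≡ length units
  length-horizontal-powers = sym (bijection⇒length≡ embed units-unique (Unique.filter⁺ horizontal? powers-unique)
    (λ _ _ → cong proj₁) into onto)
    where
    into : ∀ {t} → t ∈ units → embed t ∈ filter horizontal? powers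
    into t∈units = ∈-filter⁺ horizontal? (∈-powers⁺ (embed-≢0 (∈-units⁻ t∈units)) (embed-isPower (∈-units⁻ t∈units))) refl
    onto : ∀ {s} → s ∈ filter horizontal? powers → ∃[ t ] (t ∈ units × embed t ≡ s)
    onto {s₁ , s₂} s∈ with ∈-filter⁻ horizontal? {xs = powers} s∈
    ... | s∈powers , refl = s₁ , ∈-units⁺ (λ s₁≡0 → proj₁ (∈-powers⁻ s∈powers) (pair s₁≡0 refl)) , refl

  module MeetPointClique
    (cs : List Carrier) (cs-unique : Unique cs) (cs⇔ : ∀ c → (c ∈ cs) ⇔ IsMeetPoint m c)
    where

    -- A non-horizontal slope is t · (c - α) = (t c , - t) for a unique meet point c and t ≠ 0.
    scaledDirection : Carrier × Carrier → Fq²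
    scaledDirection (c , t) = t * c , - t

    scaledDirection-isPower : ∀ {c t} → c ∈ cs → t ≢ 0# → Ext.IsPower m (scaledDirection (c , t))
    scaledDirection-isPower {c} {t} c∈cs t≢0 = subst (Ext.IsPower m)
      (trans (cong (t ·_) (embed-⊖-α c))
        (pair (solve 3 (λ t c d → t :* c :+ d :* (con 0ℤ :* :- con 1ℤ) := t :* c) refl t c d)
              (solve 2 (λ t c → t :* :- con 1ℤ :+ con 0ℤ :* c := :- t) refl t c)))
      (isPower-· t≢0 (Equivalence.to isMeetPoint⇔ (Equivalence.to (cs⇔ c) c∈cs)))

    length-slanted-powers : length (filter (∁? horizontal?) powers) ≡ length cs ℕ.* length units
    length-slanted-powers = sym (trans (sym (length-cartesianProduct cs units))
      (bijection⇒length≡ scaledDirection (Unique.cartesianProduct⁺ cs-unique units-unique)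
        (Unique.filter⁺ (∁? horizontal?) powers-unique) injective into onto))
      where
      injective : InjectiveOn scaledDirection (cartesianProduct cs units)
      injective {c , t} {c′ , t′} ct∈ _ eq with -‿injective (cong proj₂ eq)
      ... | refl = pair (*-cancelˡ (∈-units⁻ (proj₂ (∈-cartesianProduct⁻ cs units ct∈))) (cong proj₁ eq)) refl
      into : ∀ {ct} → ct ∈ cartesianProduct cs units → scaledDirection ct ∈ filter (∁? horizontal?) powers
      into {c , t} ct∈ with ∈-cartesianProduct⁻ cs units ct∈
      ... | c∈cs , t∈units = ∈-filter⁺ (∁? horizontal?)
        (∈-powers⁺ (-t≢0 ∘′ cong proj₂) (scaledDirection-isPower c∈cs (∈-units⁻ t∈units))) -t≢0
        where
        -t≢0 = -‿≢0 (∈-units⁻ t∈units)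
      onto : ∀ {s} → s ∈ filter (∁? horizontal?) powers → ∃[ ct ] (ct ∈ cartesianProduct cs units × scaledDirection ct ≡ s)
      onto {s₁ , s₂} s∈ with ∈-filter⁻ (∁? horizontal?) {xs = powers} s∈
      ... | s∈powers , s₂≢0 = (c , t) , ∈-cartesianProduct⁺ c∈cs (∈-units⁺ t≢0) ,
          pair (trans (solve 3 (λ t s₁ i → t :* (s₁ :* i) := s₁ :* (t :* i)) refl t s₁ (t ⁻¹))
                      (trans (cong (s₁ *_) (x*x⁻¹≡1 t≢0)) (solve 1 (λ s₁ → s₁ :* con 1ℤ := s₁) refl s₁)))
               (solve 1 (λ s₂ → :- (:- s₂) := s₂) refl s₂)
        where
        t = - s₂
        t≢0 = -‿≢0 s₂≢0
        c = s₁ * t ⁻¹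
        c-α≡t⁻¹s : (c , - 1#) ≡ (t ⁻¹) · (s₁ , s₂)
        c-α≡t⁻¹s = pair (solve 4 (λ s₁ s₂ i d → s₁ :* i := i :* s₁ :+ d :* (con 0ℤ :* s₂)) refl s₁ s₂ (t ⁻¹) d)
          (sym (trans (solve 3 (λ s₁ s₂ i → i :* s₂ :+ con 0ℤ :* s₁ := :- ((:- s₂) :* i)) refl s₁ s₂ (t ⁻¹))
                      (cong -_ (x*x⁻¹≡1 t≢0))))
        c∈cs : c ∈ cs
        c∈cs = Equivalence.from (cs⇔ c) (Equivalence.from isMeetPoint⇔
          (subst (Ext.IsPower m) (sym (trans (embed-⊖-α c) c-α≡t⁻¹s))
            (isPower-· (⁻¹-≢0 t≢0) (proj₂ (∈-powers⁻ s∈powers)))))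

    1+length-cs≡k : suc (length cs) ≡ k
    1+length-cs≡k = ℕ.*-cancelʳ-≡ (suc (length cs)) k (length units) {{ℕ.>-nonZero 0<length-units}} (begin
      suc (length cs) ℕ.* length units
        ≡⟨ cong₂ ℕ._+_ (sym length-horizontal-powers) (sym length-slanted-powers) ⟩
      length (filter horizontal? powers) ℕ.+ length (filter (∁? horizontal?) powers)
        ≡⟨ length-filter-∁ horizontal? powers ⟩
      length powers
        ≡⟨ trans length-powers (ℕ.*-comm (length units) k) ⟩
      k ℕ.* length units
        ∎)
      where open ≡-Reasoning

    meetPoints-clique : IsClique m (map embed cs) × Unique (map embed cs)
    meetPoints-clique = clique , Unique.map⁺ (cong proj₁) cs-unique
      where
      clique : IsClique m (map embed cs)
      clique x∈ y∈ x≢y with ∈-map⁻ embed x∈ | ∈-map⁻ embed y∈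
      ... | c , _ , refl | c′ , _ , refl = adjacent {embed c} {embed c′} x≢y (subst (Ext.IsPower m)
        (pair refl (solve 0 (con 0ℤ := con 0ℤ :- con 0ℤ) refl))
        (embed-isPower (x≢y ∘′ cong embed ∘′ x-y≡0⇒x≡y)))

    α~meetPoints : ∀ {y} → y ∈ map embed cs → Adj m α y
    α~meetPoints y∈ with ∈-map⁻ embed y∈
    ... | c , c∈cs , refl = adjacent-sym (adjacent {embed c} {α} (0≢1 ∘′ cong proj₂)
      (Equivalence.to isMeetPoint⇔ (Equivalence.to (cs⇔ c) c∈cs)))

    -α~meetPoints : ∀ {y} → y ∈ map embed cs → Adj m (⊖ α) y
    -α~meetPoints y∈ with ∈-map⁻ embed y∈
    ... | c , c∈cs , refl = adjacent-sym (adjacent {embed c} {⊖ α} (-‿≢0 (0≢1 ∘′ sym) ∘′ sym ∘′ cong proj₂)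
      (subst (Ext.IsPower m)
        (pair (solve 1 (λ c → c :- con 0ℤ := c :- (:- con 0ℤ)) refl c)
              (solve 0 (:- (con 0ℤ :- con 1ℤ) := con 0ℤ :- (:- con 1ℤ)) refl))
        (isPower-conj {m} (Equivalence.to isMeetPoint⇔ (Equivalence.to (cs⇔ c) c∈cs)))))

    clique : IsClique m (α ∷ map embed cs) × Unique (α ∷ map embed cs)
    clique = clique-∷ α~meetPoints meetPoints-clique

    clique-± : 1# + 1# ≢ 0# → 2 ∣ k → IsClique m (α ∷ ⊖ α ∷ map embed cs) × Unique (α ∷ ⊖ α ∷ map embed cs)
    clique-± 2≢0 2∣k = clique-∷ α~rest (clique-∷ -α~meetPoints meetPoints-clique)
      where
      α~rest : ∀ {y} → y ∈ ⊖ α ∷ map embed cs → Adj m α y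
      α~rest (here refl) = α~-α 2≢0 2∣k
      α~rest (there y∈)  = α~meetPoints y∈

    m*size≡q+1 : m ℕ.* length (α ∷ map embed cs) ≡ suc order
    m*size≡q+1 = trans (cong (λ n → m ℕ.* suc n) (length-map embed cs))
      (trans (cong (m ℕ.*_) 1+length-cs≡k) (trans (ℕ.*-comm m k) (sym q+1≡k*m)))

    m*size-±≡q+1+m : m ℕ.* length (α ∷ ⊖ α ∷ map embed cs) ≡ suc order ℕ.+ m
    m*size-±≡q+1+m = trans (ℕ.*-suc m _) (trans (cong (m ℕ.+_) m*size≡q+1) (ℕ.+-comm m _))

open import Data.Nat using (_+_; _*_)

proposition4p6 : (F : FiniteField) →
    IsPrimePower (FiniteField.order F) → ¬ (2 ∣ FiniteField.order F) →
    (m : ℕ) → m ≥ 2 → m ∣ suc (FiniteField.order F) →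
    (d : FiniteField.Carrier F) → IsNonSquare F d →
    let open QuadExt F d in
    (cs : List (FiniteField.Carrier F)) → Unique cs → (∀ c → (c ∈ cs) ⇔ IsMeetPoint m c) →
    ((¬ (m ∣ suc (FiniteField.order F) / 2)) →
       IsClique m (α ∷ map embed cs) × Unique (α ∷ map embed cs)
       × m * length (α ∷ map embed cs) ≡ suc (FiniteField.order F))
    × ((m ∣ suc (FiniteField.order F) / 2) →
       IsClique m (α ∷ (⊖ α) ∷ map embed cs) × Unique (α ∷ (⊖ α) ∷ map embed cs)
       × m * length (α ∷ (⊖ α) ∷ map embed cs) ≡ suc (FiniteField.order F) + m)
proposition4p6 F _ q-odd m (s≤s _) (divides k q+1≡k*m) d d-nonsquare cs cs-unique cs⇔ =
  (λ _ → assocʳ′ (clique , m*size≡q+1)) ,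
  (λ m∣[q+1]/2 → assocʳ′ (clique-± (odd-order⇒2≢0 q-odd) (m∣[n+1]/2⇒2∣quotient q-odd q+1≡k*m m∣[q+1]/2) ,
                          m*size-±≡q+1+m))
  where
  open FiniteFieldProperties F using (odd-order⇒2≢0)
  open MaryLines.MeetPointClique F d d-nonsquare m k q+1≡k*m cs cs-unique cs⇔
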